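{- Let $n\ge1$ and let $(h_{i,j},v_{i,j},d_{i,j})_{1\le i,j\le n}$ be an $n\times n$ Alternating Phase Matrix of type 4, and set $a_{i,j}=-\omega h_{i,j}+\omega^2v_{i,j}$ with $\omega=e^{2\pi i/3}$. Then $\sum_{i,j=1}^na_{i,j}=0$.
   Context: An $n\times n$ Alternating Phase Matrix of type 4 is an $n\times n$ array of triples $(h_{i,j},v_{i,j},d_{i,j})$ with $h_{i,j},v_{i,j},d_{i,j}\in\{0,1,-1\}$ and $h_{i,j}+v_{i,j}+d_{i,j}=0$, such that: (1) in each row $i$, the nonzero $h_{i,j}$, read for $j=1,\dots,n$, alternate $1,-1,1,\dots,-1$ (starting with $1$, ending with $-1$); (2) in each column $j$, the nonzero $v_{i,j}$, read for $i=1,\dots,n$, alternate $1,-1,1,\dots,-1$; (3) along each diagonal $\ell\in[1-n,n-1]$, the nonzero $d_{i,i+\ell}$, read for $i$ from $\max(1,1-\ell)$ to $\min(n,n-\ell)$, alternate $-1,1,-1,\dots,1$. -}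

module Defs where

open import Data.Nat using (ℕ)
open import Data.Integer using (ℤ; +_; -_; _+_; _-_; _*_; 0ℤ; 1ℤ; -1ℤ; _≟_)
open import Data.Fin using (Fin; toℕ)
open import Data.List using (List; []; _∷_; map; filter; concat; allFin; foldr)
open import Data.Product using (_×_; _,_)
open import Data.Sum using (_⊎_)
open import Relation.Binary.PropositionalEquality using (_≡_)
open import Relation.Nullary using (¬_; ¬?)

-- Eisenstein integers ℤ[ω], ω = e^{2πi/3}; mkℤω a b represents a + b·ω,
-- with the defining relation ω² = -1 - ω.

record ℤω : Set where
  constructor mkℤω
  field
    re : ℤ
    im : ℤ

open ℤω public

infixl 6 _+ω_
infixl 7 _*ω_

_+ω_ : ℤω → ℤω → ℤω
mkℤω a b +ω mkℤω c d = mkℤω (a + c) (b + d)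

-- (a + bω)(c + dω) = ac + (ad + bc)ω + bd ω² = (ac - bd) + (ad + bc - bd)ω
_*ω_ : ℤω → ℤω → ℤω
mkℤω a b *ω mkℤω c d = mkℤω (a * c - b * d) (a * d + b * c - b * d)

0ω : ℤω
0ω = mkℤω 0ℤ 0ℤ

ι : ℤ → ℤω
ι x = mkℤω x 0ℤ

ω : ℤω
ω = mkℤω 0ℤ 1ℤ

sumω : List ℤω → ℤω
sumω = foldr _+ω_ 0ω

Trit : ℤ → Set
Trit x = x ≡ 0ℤ ⊎ x ≡ 1ℤ ⊎ x ≡ -1ℤ

nonzeros : List ℤ → List ℤ
nonzeros = filter (λ x → ¬? (x ≟ 0ℤ))

data AltPos : List ℤ → Set where
  []    : AltPos []
  step  : ∀ {xs} → AltPos xs → AltPos (1ℤ ∷ -1ℤ ∷ xs)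

data AltNeg : List ℤ → Set where
  []    : AltNeg []
  step  : ∀ {xs} → AltNeg xs → AltNeg (-1ℤ ∷ 1ℤ ∷ xs)

Mat : ℕ → Set
Mat n = Fin n → Fin n → ℤ

rowList : ∀ {n} → Mat n → Fin n → List ℤ
rowList {n} m i = map (λ j → m i j) (allFin n)

colList : ∀ {n} → Mat n → Fin n → List ℤ
colList {n} m j = map (λ i → m i j) (allFin n)

-- diagonal ℓ: entries m i j with j = i + ℓ, read in increasing i
-- (empty when ℓ ∉ [1-n, n-1])
diagList : ∀ {n} → Mat n → ℤ → List ℤ
diagList {n} m ℓ =
  concat (map (λ i → map (λ j → m i j)
                         (filter (λ j → (+ toℕ j) ≟ ((+ toℕ i) + ℓ)) (allFin n)))
              (allFin n))

IsAPM4 : (n : ℕ) → Mat n → Mat n → Mat n → Set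
IsAPM4 n h v d =
  (∀ i j → Trit (h i j) × Trit (v i j) × Trit (d i j)) ×
  (∀ i j → h i j + v i j + d i j ≡ 0ℤ) ×
  (∀ i → AltPos (nonzeros (rowList h i))) ×
  (∀ j → AltPos (nonzeros (colList v j))) ×
  (∀ ℓ → AltNeg (nonzeros (diagList d ℓ)))

aEntry : ∀ {n} → Mat n → Mat n → Fin n → Fin n → ℤω
aEntry h v i j = ι (- h i j) *ω ω +ω (ω *ω ω) *ω ι (v i j)

sumA : ∀ {n} → Mat n → Mat n → ℤω
sumA {n} h v = sumω (concat (map (λ i → map (λ j → aEntry h v i j) (allFin n)) (allFin n)))

-- The map (x , y) ↦ -ωx + ω²y is additive, so Σ a_{i,j} = -ω H + ω² V with
-- H = Σ h_{i,j} and V = Σ v_{i,j}. Both vanish: H is a sum of row sums and V a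
-- sum of column sums, and a list whose nonzero entries read 1,-1,…,1,-1 sums to 0.
module Submission where

open import Defs
open import Data.Nat using (ℕ; _≤_)
open import Data.Integer using (ℤ; -_; _+_; _-_; _*_; 0ℤ; 1ℤ; -1ℤ; _≟_)
open import Data.Integer.Properties using (+-assoc; +-identityˡ)
open import Data.Integer.Tactic.RingSolver using (solve-∀)
open import Data.List using (List; []; _∷_; map; concat; allFin; foldr; _++_)
open import Data.List.Properties using (map-cong; map-∘)
open import Data.Product using (_,_)
open import Relation.Binary.PropositionalEquality
  using (_≡_; refl; sym; trans; cong; cong₂; module ≡-Reasoning)
open import Relation.Nullary using (yes; no)

sumℤ : List ℤ → ℤ
sumℤ = foldr _+_ 0ℤ

sumℤ-nonzeros : (xs : List ℤ) → sumℤ (nonzeros xs) ≡ sumℤ xs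
sumℤ-nonzeros [] = refl
sumℤ-nonzeros (x ∷ xs) with x ≟ 0ℤ
... | yes refl = trans (sumℤ-nonzeros xs) (sym (+-identityˡ _))
... | no _     = cong (x +_) (sumℤ-nonzeros xs)

AltPos⇒sumℤ≡0 : ∀ {xs} → AltPos xs → sumℤ xs ≡ 0ℤ
AltPos⇒sumℤ≡0 []       = refl
AltPos⇒sumℤ≡0 (step a) = cong (λ s → 1ℤ + (-1ℤ + s)) (AltPos⇒sumℤ≡0 a)

alternating⇒sumℤ≡0 : (xs : List ℤ) → AltPos (nonzeros xs) → sumℤ xs ≡ 0ℤ
alternating⇒sumℤ≡0 xs alt = trans (sym (sumℤ-nonzeros xs)) (AltPos⇒sumℤ≡0 alt)

sumℤ-map-+ : ∀ {A : Set} (f g : A → ℤ) (xs : List A) →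
  sumℤ (map (λ x → f x + g x) xs) ≡ sumℤ (map f xs) + sumℤ (map g xs)
sumℤ-map-+ f g [] = refl
sumℤ-map-+ f g (x ∷ xs) =
  trans (cong (f x + g x +_) (sumℤ-map-+ f g xs)) (interchange (f x) (g x) _ _)
  where
  interchange : ∀ a b c d → (a + b) + (c + d) ≡ (a + c) + (b + d)
  interchange = solve-∀

sumℤ-map-zero : ∀ {A : Set} (f : A → ℤ) (xs : List A) →
  (∀ x → f x ≡ 0ℤ) → sumℤ (map f xs) ≡ 0ℤ
sumℤ-map-zero f [] _ = refl
sumℤ-map-zero f (x ∷ xs) f≡0 = cong₂ _+_ (f≡0 x) (sumℤ-map-zero f xs f≡0)

sumℤ-comm : ∀ {A B : Set} (f : A → B → ℤ) (I : List A) (J : List B) →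
  sumℤ (map (λ i → sumℤ (map (f i) J)) I) ≡ sumℤ (map (λ j → sumℤ (map (λ i → f i j) I)) J)
sumℤ-comm f [] J = sym (sumℤ-map-zero _ J (λ _ → refl))
sumℤ-comm f (i ∷ I) J =
  trans (cong (sumℤ (map (f i) J) +_) (sumℤ-comm f I J))
        (sym (sumℤ-map-+ (f i) (λ j → sumℤ (map (λ i → f i j) I)) J))

+ω-assoc : ∀ x y z → (x +ω y) +ω z ≡ x +ω (y +ω z)
+ω-assoc (mkℤω a b) (mkℤω c d) (mkℤω e f) = cong₂ mkℤω (+-assoc a c e) (+-assoc b d f)

+ω-identityˡ : ∀ x → 0ω +ω x ≡ x
+ω-identityˡ (mkℤω a b) = cong₂ mkℤω (+-identityˡ a) (+-identityˡ b)

sumω-++ : (xs ys : List ℤω) → sumω (xs ++ ys) ≡ sumω xs +ω sumω ys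
sumω-++ [] ys = sym (+ω-identityˡ _)
sumω-++ (x ∷ xs) ys = trans (cong (x +ω_) (sumω-++ xs ys)) (sym (+ω-assoc x _ _))

sumω-concat : (xss : List (List ℤω)) → sumω (concat xss) ≡ sumω (map sumω xss)
sumω-concat [] = refl
sumω-concat (xs ∷ xss) = trans (sumω-++ xs (concat xss)) (cong (sumω xs +ω_) (sumω-concat xss))

phase : ℤ → ℤ → ℤω
phase x y = ι (- x) *ω ω +ω (ω *ω ω) *ω ι y

phase-normal : ∀ x y → phase x y ≡ mkℤω (- y) (- x - y)
phase-normal x y = cong₂ mkℤω (real x y) (imaginary x y)
  where
  real : ∀ x y → ((- x) * 0ℤ - 0ℤ * 1ℤ) + (-1ℤ * y - -1ℤ * 0ℤ) ≡ - y
  real = solve-∀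
  imaginary : ∀ x y →
    ((- x) * 1ℤ + 0ℤ * 0ℤ - 0ℤ * 1ℤ) + (-1ℤ * 0ℤ + -1ℤ * y - -1ℤ * 0ℤ) ≡ - x - y
  imaginary = solve-∀

phase-+ : ∀ x x′ y y′ → phase (x + x′) (y + y′) ≡ phase x y +ω phase x′ y′
phase-+ x x′ y y′ = begin
  phase (x + x′) (y + y′)                     ≡⟨ phase-normal (x + x′) (y + y′) ⟩
  mkℤω (- (y + y′)) (- (x + x′) - (y + y′))   ≡⟨ cong₂ mkℤω (real y y′) (imaginary x x′ y y′) ⟩
  mkℤω (- y) (- x - y) +ω mkℤω (- y′) (- x′ - y′)
    ≡⟨ sym (cong₂ _+ω_ (phase-normal x y) (phase-normal x′ y′)) ⟩
  phase x y +ω phase x′ y′                    ∎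
  where
  open ≡-Reasoning
  real : ∀ y y′ → - (y + y′) ≡ - y + - y′
  real = solve-∀
  imaginary : ∀ x x′ y y′ → - (x + x′) - (y + y′) ≡ (- x - y) + (- x′ - y′)
  imaginary = solve-∀

sumω-map-phase : ∀ {A : Set} (f g : A → ℤ) (xs : List A) →
  sumω (map (λ x → phase (f x) (g x)) xs) ≡ phase (sumℤ (map f xs)) (sumℤ (map g xs))
sumω-map-phase f g [] = refl
sumω-map-phase f g (x ∷ xs) =
  trans (cong (phase (f x) (g x) +ω_) (sumω-map-phase f g xs))
        (sym (phase-+ (f x) _ (g x) _))

doubleSum : ∀ {n} → Mat n → ℤ
doubleSum {n} m = sumℤ (map (λ i → sumℤ (map (m i) (allFin n))) (allFin n))

sumA≡phase : ∀ {n} (h v : Mat n) → sumA h v ≡ phase (doubleSum h) (doubleSum v)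
sumA≡phase {n} h v = begin
  sumA h v
    ≡⟨ sumω-concat (map (λ i → map (aEntry h v i) I) I) ⟩
  sumω (map sumω (map (λ i → map (aEntry h v i) I) I))
    ≡⟨ cong sumω (sym (map-∘ I)) ⟩
  sumω (map (λ i → sumω (map (aEntry h v i) I)) I)
    ≡⟨ cong sumω (map-cong (λ i → sumω-map-phase (h i) (v i) I) I) ⟩
  sumω (map (λ i → phase (sumℤ (map (h i) I)) (sumℤ (map (v i) I))) I)
    ≡⟨ sumω-map-phase _ _ I ⟩
  phase (doubleSum h) (doubleSum v) ∎
  where
  open ≡-Reasoning
  I = allFin n

proposition7p7 : (n : ℕ) → 1 ≤ n → (h v d : Mat n) →
    IsAPM4 n h v d → sumA h v ≡ 0ω
proposition7p7 n _ h v d (_ , _ , rows , cols , _) = begin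
  sumA h v                          ≡⟨ sumA≡phase h v ⟩
  phase (doubleSum h) (doubleSum v) ≡⟨ cong₂ phase rowSums colSums ⟩
  phase 0ℤ 0ℤ                       ≡⟨⟩
  0ω                                ∎
  where
  open ≡-Reasoning
  I = allFin n
  rowSums : doubleSum h ≡ 0ℤ
  rowSums = sumℤ-map-zero _ I (λ i → alternating⇒sumℤ≡0 (map (h i) I) (rows i))
  colSums : doubleSum v ≡ 0ℤ
  colSums = trans (sumℤ-comm v I I)
                  (sumℤ-map-zero _ I (λ j → alternating⇒sumℤ≡0 (map (λ i → v i j) I) (cols j)))
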